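{- Let $k$ and $n$ be positive integers and let $\phi:E(K_n)\to[k]$ be a monochromatic coloring of the edges of $K_n$. Then \[ w(\phi,k)=(k-1)2^{n}-(k-2). \]
   Context: An edge coloring of a complete graph is a Gallai coloring if it contains no triangle whose three edges have three distinct colors. For a Gallai coloring $\phi$ of $E(K_n)$ with colors in $[k]=\{1,\dots,k\}$, $w(\phi,k)$ denotes the number of ways to extend $\phi$ to a Gallai coloring of $E(K_{n+1})$ (obtained by adding one new vertex joined to all vertices of $K_n$) in which the new edges receive colors from $[k]$, regardless of how many colors actually appear in $\phi$. -}

module Defs where

open import Data.Nat as ℕ using (ℕ; zero; suc)
open import Data.Nat.Properties as ℕP using ()
open import Data.Fin using (Fin; zero; suc; _<_)
open import Data.Fin.Properties using (_≟_; _<?_; <-irrelevant; all?)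
open import Data.Vec using (Vec; []; _∷_; lookup)
open import Data.List using (List; []; _∷_; concatMap; map; length; filter)
open import Data.Empty using (⊥-elim)
open import Data.Product using (_×_; _,_; ∃-syntax)
open import Relation.Nullary using (¬_; Dec; yes; no)
open import Relation.Nullary.Decidable using (_×-dec_; ¬?)
open import Relation.Binary.PropositionalEquality using (_≡_; _≢_; refl)

-- An edge colouring of K_n with colours in [k] = Fin k.
-- The edge {i,j} (i ≠ j) is represented by the ordered pair i < j.
Coloring : ℕ → ℕ → Set
Coloring n k = (i j : Fin n) → i < j → Fin k

Rainbow : ∀ {k} → Fin k → Fin k → Fin k → Set
Rainbow a b c = (a ≢ b) × (b ≢ c) × (a ≢ c)

Gallai : ∀ {n k} → Coloring n k → Set
Gallai {n} c = (i j l : Fin n) (p : i < j) (q : j < l) (r : i < l) →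
  ¬ Rainbow (c i j p) (c j l q) (c i l r)

Monochromatic : ∀ {n k} → Coloring n k → Set
Monochromatic {n} {k} c = ∃[ a ] ((i j : Fin n) (p : i < j) → c i j p ≡ a)

-- Extension of a colouring of K_n to K_{n+1}: the new vertex is `zero`,
-- old vertex i becomes `suc i`, and the new edge {new, suc i} gets colour f[i].
extend : ∀ {n k} → Coloring n k → Vec (Fin k) n → Coloring (suc n) k
extend c f zero    (suc j) _ = lookup f j
extend c f (suc i) (suc j) p = c i j (ℕP.≤-pred p)

allVecs : (n k : ℕ) → List (Vec (Fin k) n)
allVecs zero    k = [] ∷ []
allVecs (suc n) k = concatMap (λ v → map (_∷ v) (allFinList k)) (allVecs n k)
  where
  allFinList : (k : ℕ) → List (Fin k)
  allFinList zero    = []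
  allFinList (suc k) = zero ∷ map suc (allFinList k)

private
  rainbow? : ∀ {k} (a b c : Fin k) → Dec (Rainbow a b c)
  rainbow? a b c = ¬? (a ≟ b) ×-dec (¬? (b ≟ c) ×-dec ¬? (a ≟ c))

  subst′ : ∀ {n} {i j : Fin n} (A : i < j → Set) {x y} → x ≡ y → A x → A y
  subst′ A refl a = a

  lt-dec : ∀ {n} (i j : Fin n) {P : i < j → Set} →
           ((p : i < j) → Dec (P p)) → Dec ((p : i < j) → P p)
  lt-dec i j {P} P? with i <? j
  ... | no ¬p = yes λ p → ⊥-elim (¬p p)
  ... | yes p with P? p
  ...   | yes x = yes λ p′ → subst′ P (<-irrelevant p p′) x
  ...   | no ¬x = no λ h → ¬x (h p)

gallai? : ∀ {n k} (c : Coloring n k) → Dec (Gallai c)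
gallai? c = all? λ i → all? λ j → all? λ l →
  lt-dec i j λ p → lt-dec j l λ q → lt-dec i l λ r →
  ¬? (rainbow? (c i j p) (c j l q) (c i l r))

w : ∀ {n} {k} (φ : Coloring n k) → ℕ
w {n} {k} φ = length (filter (λ f → gallai? (extend φ f)) (allVecs n k))

-- Let a be the colour of φ. A triangle through the new vertex is rainbow exactly when its two
-- new edges have distinct colours both different from a, and a triangle of old vertices is
-- monochromatic. So the Gallai extensions are the colourings f of the new edges that use at most
-- one colour besides a: the constant colouring a, and, for each of the k − 1 colours b ≠ a, the
-- 2ⁿ − 1 non-constant colourings with values in {a, b}. This gives 1 + (k − 1)(2ⁿ − 1) extensions.
-- To count them, f is read entry by entry while tracking which colours besides a have appeared;
-- the number t(n) of f with exactly one such colour satisfies t(n + 1) = (k − 1) + 2 t(n).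
module Submission where

open import Defs
open import Data.Bool using (true; false; if_then_else_)
open import Data.Empty using (⊥-elim)
open import Data.Fin using (Fin; zero; suc; _<_)
open import Data.Fin.Properties using (_≟_; <-cmp)
open import Data.List using (List; []; _∷_; _++_; map; concatMap; length; filter)
open import Data.List.Properties using (length-map)
open import Data.Nat using (ℕ; zero; suc; _≤_; _^_; s≤s; z≤n)
open import Data.Product using (_×_; _,_; ∃-syntax)
open import Data.Sum using (_⊎_; inj₁; inj₂)
open import Data.Vec using (Vec; []; _∷_; head; lookup)
open import Function using (_∘_; _⇔_; mk⇔)
open import Function.Properties.Equivalence using () renaming (trans to ⇔-trans)
open import Relation.Binary.Definitions using (tri<; tri≈; tri>)
open import Relation.Binary.PropositionalEquality
  using (_≡_; _≢_; refl; sym; trans; cong; cong₂; module ≡-Reasoning)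
open import Relation.Nullary using (¬_; Dec; yes; no; does; ¬?)
open import Relation.Nullary.Decidable using (does-⇔)

AtMostOneOther : ∀ {n k} → Fin k → Vec (Fin k) n → Set
AtMostOneOther a f = ∀ i j → lookup f i ≢ a → lookup f j ≢ a → lookup f i ≡ lookup f j

atMostOneOther-tail : ∀ {n k} {a x : Fin k} {v : Vec (Fin k) n} →
                      AtMostOneOther a (x ∷ v) → AtMostOneOther a v
atMostOneOther-tail g i j = g (suc i) (suc j)

⊆[a,b]⇒atMostOneOther : ∀ {n k} {a b : Fin k} (f : Vec (Fin k) n) →
                        (∀ i → lookup f i ≡ a ⊎ lookup f i ≡ b) → AtMostOneOther a f
⊆[a,b]⇒atMostOneOther f f⊆ab i j fi≢a fj≢a with f⊆ab i | f⊆ab j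
... | inj₁ fi≡a | _         = ⊥-elim (fi≢a fi≡a)
... | inj₂ _    | inj₁ fj≡a = ⊥-elim (fj≢a fj≡a)
... | inj₂ fi≡b | inj₂ fj≡b = trans fi≡b (sym fj≡b)

data OtherColours (k : ℕ) : Set where
  none : OtherColours k
  one  : Fin k → OtherColours k
  many : OtherColours k

module _ {k : ℕ} (a : Fin k) where

  insert : Fin k → OtherColours k → OtherColours k
  insert x s with x ≟ a
  ... | yes _ = s
  insert x none    | no _ = one x
  insert x (one b) | no _ with x ≟ b
  ...   | yes _ = one b
  ...   | no _  = many
  insert x many    | no _ = many

  otherColours : ∀ {n} → Vec (Fin k) n → OtherColours k
  otherColours []      = none
  otherColours (x ∷ v) = insert x (otherColours v)

  Describes : ∀ {n} → Vec (Fin k) n → OtherColours k → Set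
  Describes f none    = ∀ i → lookup f i ≡ a
  Describes f (one b) = b ≢ a × (∀ i → lookup f i ≡ a ⊎ lookup f i ≡ b) × ∃[ j ] lookup f j ≡ b
  Describes f many    = ¬ AtMostOneOther a f

  insert-describes : ∀ {n} x {v : Vec (Fin k) n} s → Describes v s → Describes (x ∷ v) (insert x s)
  insert-describes x s d with x ≟ a
  insert-describes x none d | yes x≡a = λ { zero → x≡a ; (suc i) → d i }
  insert-describes x (one b) (b≢a , v⊆ab , j , vj≡b) | yes x≡a =
    b≢a , (λ { zero → inj₁ x≡a ; (suc i) → v⊆ab i }) , suc j , vj≡b
  insert-describes x many d | yes _ = d ∘ atMostOneOther-tail
  insert-describes x none d | no x≢a =
    x≢a , (λ { zero → inj₂ refl ; (suc i) → inj₁ (d i) }) , zero , refl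
  insert-describes x (one b) d | no _ with x ≟ b
  insert-describes x (one b) (b≢a , v⊆ab , j , vj≡b) | no _ | yes refl =
    b≢a , (λ { zero → inj₂ refl ; (suc i) → v⊆ab i }) , suc j , vj≡b
  insert-describes x (one b) (b≢a , _ , j , vj≡b) | no x≢a | no x≢b = λ g →
    x≢b (trans (g zero (suc j) x≢a (λ vj≡a → b≢a (trans (sym vj≡b) vj≡a))) vj≡b)
  insert-describes x many d | no _ = d ∘ atMostOneOther-tail

  otherColours-describes : ∀ {n} (f : Vec (Fin k) n) → Describes f (otherColours f)
  otherColours-describes []      = λ ()
  otherColours-describes (x ∷ v) = insert-describes x (otherColours v) (otherColours-describes v)

  atMostOneOther⇔≢many : ∀ {n} (f : Vec (Fin k) n) s → Describes f s → AtMostOneOther a f ⇔ s ≢ many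
  atMostOneOther⇔≢many f none    f≡a            =
    mk⇔ (λ _ ()) (λ _ → ⊆[a,b]⇒atMostOneOther {b = a} f (inj₁ ∘ f≡a))
  atMostOneOther⇔≢many f (one b) (_ , f⊆ab , _) = mk⇔ (λ _ ()) (λ _ → ⊆[a,b]⇒atMostOneOther f f⊆ab)
  atMostOneOther⇔≢many f many    ¬f             = mk⇔ (λ g _ → ¬f g) (λ many≢many → ⊥-elim (many≢many refl))

module _ {n k} {φ : Coloring n k} {a : Fin k}
         (φ≡a : (i j : Fin n) (p : i < j) → φ i j p ≡ a) where

  gallai-extend⁺ : (f : Vec (Fin k) n) → AtMostOneOther a f → Gallai (extend φ f)
  gallai-extend⁺ f g zero    zero    _       ()
  gallai-extend⁺ f g zero    (suc j) zero    _ ()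
  gallai-extend⁺ f g zero    (suc j) (suc l) _ _ _ (fj≢φ , φ≢fl , fj≢fl) =
    fj≢fl (g j l (λ fj≡a → fj≢φ (trans fj≡a (sym (φ≡a _ _ _))))
                 (λ fl≡a → φ≢fl (trans (φ≡a _ _ _) (sym fl≡a))))
  gallai-extend⁺ f g (suc i) zero    _       ()
  gallai-extend⁺ f g (suc i) (suc j) zero    _ ()
  gallai-extend⁺ f g (suc i) (suc j) (suc l) _ _ _ (φ≢φ , _) =
    φ≢φ (trans (φ≡a _ _ _) (sym (φ≡a _ _ _)))

  gallai-extend⁻ : (f : Vec (Fin k) n) → Gallai (extend φ f) → AtMostOneOther a f
  gallai-extend⁻ f g i j fi≢a fj≢a with lookup f i ≟ lookup f j
  ... | yes fi≡fj = fi≡fj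
  ... | no fi≢fj with <-cmp i j
  ...   | tri≈ _ i≡j _ = ⊥-elim (fi≢fj (cong (lookup f) i≡j))
  ...   | tri< i<j _ _ = ⊥-elim (g zero (suc i) (suc j) (s≤s z≤n) (s≤s i<j) (s≤s z≤n)
            ((λ fi≡φ → fi≢a (trans fi≡φ (φ≡a _ _ _))) ,
             (λ φ≡fj → fj≢a (trans (sym φ≡fj) (φ≡a _ _ _))) , fi≢fj))
  ...   | tri> _ _ j<i = ⊥-elim (g zero (suc j) (suc i) (s≤s z≤n) (s≤s j<i) (s≤s z≤n)
            ((λ fj≡φ → fj≢a (trans fj≡φ (φ≡a _ _ _))) ,
             (λ φ≡fi → fi≢a (trans (sym φ≡fi) (φ≡a _ _ _))) , fi≢fj ∘ sym))

  gallai-extend⇔≢many : (f : Vec (Fin k) n) → Gallai (extend φ f) ⇔ otherColours a f ≢ many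
  gallai-extend⇔≢many f = ⇔-trans (mk⇔ (gallai-extend⁻ f) (gallai-extend⁺ f))
                                 (atMostOneOther⇔≢many a f (otherColours a f) (otherColours-describes a f))

⟦_⟧ : ∀ {P : Set} → Dec P → ℕ
⟦ d ⟧ = if does d then 1 else 0

isNone isOne : ∀ {k} → OtherColours k → ℕ
isNone none = 1
isNone _    = 0
isOne (one _) = 1
isOne _       = 0

few? : ∀ {k} (s : OtherColours k) → Dec (s ≢ many)
few? none    = yes λ ()
few? (one _) = yes λ ()
few? many    = no λ many≢many → many≢many refl

module _ where
  open import Data.Nat using (_+_; _*_)
  open import Data.Nat.Properties
    using (+-assoc; +-comm; +-suc; +-identityʳ; *-identityʳ; *-zeroʳ; *-distribˡ-+; +-commutativeSemigroup)
  open import Algebra.Properties.CommutativeSemigroup +-commutativeSemigroup using (interchange)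

  ⟦few?⟧ : ∀ {k} (s : OtherColours k) → ⟦ few? s ⟧ ≡ isNone s + isOne s
  ⟦few?⟧ none    = refl
  ⟦few?⟧ (one _) = refl
  ⟦few?⟧ many    = refl

  private variable
    A B : Set

  ∑ : List A → (A → ℕ) → ℕ
  ∑ []       h = 0
  ∑ (x ∷ xs) h = h x + ∑ xs h

  syntax ∑ xs (λ x → e) = ∑[ x ∈ xs ] e

  ∑-zero : (xs : List A) → ∑[ x ∈ xs ] 0 ≡ 0
  ∑-zero []       = refl
  ∑-zero (x ∷ xs) = ∑-zero xs

  ∑-cong : (xs : List A) {h h′ : A → ℕ} → (∀ x → h x ≡ h′ x) → ∑ xs h ≡ ∑ xs h′
  ∑-cong []       h≡h′ = refl
  ∑-cong (x ∷ xs) h≡h′ = cong₂ _+_ (h≡h′ x) (∑-cong xs h≡h′)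

  ∑-++ : (xs ys : List A) (h : A → ℕ) → ∑ (xs ++ ys) h ≡ ∑ xs h + ∑ ys h
  ∑-++ []       ys h = refl
  ∑-++ (x ∷ xs) ys h = trans (cong (h x +_) (∑-++ xs ys h)) (sym (+-assoc (h x) _ _))

  ∑-map : (g : A → B) (xs : List A) (h : B → ℕ) → ∑ (map g xs) h ≡ ∑[ x ∈ xs ] h (g x)
  ∑-map g []       h = refl
  ∑-map g (x ∷ xs) h = cong (h (g x) +_) (∑-map g xs h)

  ∑-concatMap : (g : A → List B) (xs : List A) (h : B → ℕ) →
                ∑ (concatMap g xs) h ≡ ∑[ x ∈ xs ] ∑ (g x) h
  ∑-concatMap g []       h = refl
  ∑-concatMap g (x ∷ xs) h = trans (∑-++ (g x) _ h) (cong (∑ (g x) h +_) (∑-concatMap g xs h))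

  ∑-+ : (xs : List A) (h h′ : A → ℕ) → ∑[ x ∈ xs ] (h x + h′ x) ≡ ∑ xs h + ∑ xs h′
  ∑-+ []       h h′ = refl
  ∑-+ (x ∷ xs) h h′ = trans (cong (h x + h′ x +_) (∑-+ xs h h′)) (interchange (h x) (h′ x) _ _)

  ∑-*ˡ : (c : ℕ) (xs : List A) (h : A → ℕ) → ∑[ x ∈ xs ] (c * h x) ≡ c * ∑ xs h
  ∑-*ˡ c []       h = sym (*-zeroʳ c)
  ∑-*ˡ c (x ∷ xs) h = trans (cong (c * h x +_) (∑-*ˡ c xs h)) (sym (*-distribˡ-+ c (h x) _))

  length-filter≡∑ : {P : A → Set} (P? : ∀ x → Dec (P x)) (xs : List A) →
                    length (filter P? xs) ≡ ∑[ x ∈ xs ] ⟦ P? x ⟧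
  length-filter≡∑ P? []       = refl
  length-filter≡∑ P? (x ∷ xs) with does (P? x)
  ... | true  = cong suc (length-filter≡∑ P? xs)
  ... | false = length-filter≡∑ P? xs

  ∑⟦P⟧+∑⟦¬P⟧≡length : {P : A → Set} (P? : ∀ x → Dec (P x)) (xs : List A) →
                      ∑[ x ∈ xs ] ⟦ P? x ⟧ + ∑[ x ∈ xs ] ⟦ ¬? (P? x) ⟧ ≡ length xs
  ∑⟦P⟧+∑⟦¬P⟧≡length P? []       = refl
  ∑⟦P⟧+∑⟦¬P⟧≡length P? (x ∷ xs) with does (P? x)
  ... | true  = cong suc (∑⟦P⟧+∑⟦¬P⟧≡length P? xs)
  ... | false = trans (+-suc _ _) (cong suc (∑⟦P⟧+∑⟦¬P⟧≡length P? xs))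

  -- allVecs draws its colours from a local list; colours recovers that list from the vectors of length 1.
  colours : (k : ℕ) → List (Fin k)
  colours k = map head (allVecs 1 k)

  heads-of-singletons : (xs : List A) → map head (map (_∷ []) xs ++ []) ≡ xs
  heads-of-singletons []       = refl
  heads-of-singletons (x ∷ xs) = cong (x ∷_) (heads-of-singletons xs)

  colours-suc : ∀ k → colours (suc k) ≡ zero ∷ map suc (colours k)
  colours-suc k = cong (zero ∷_) (trans (heads-of-singletons _) (cong (map suc) (sym (heads-of-singletons _))))

  length-colours : ∀ k → length (colours k) ≡ k
  length-colours zero    = refl
  length-colours (suc k) =
    trans (cong length (colours-suc k)) (cong suc (trans (length-map suc (colours k)) (length-colours k)))

  allVecs-suc : ∀ n k → allVecs (suc n) k ≡ concatMap (λ v → map (_∷ v) (colours k)) (allVecs n k)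
  allVecs-suc n k = cong (λ xs → concatMap (λ v → map (_∷ v) xs) (allVecs n k)) (sym (heads-of-singletons _))

  ∑-allVecs-suc : ∀ n k (h : Vec (Fin k) (suc n) → ℕ) →
                  ∑ (allVecs (suc n) k) h ≡ ∑[ v ∈ allVecs n k ] ∑[ x ∈ colours k ] h (x ∷ v)
  ∑-allVecs-suc n k h = begin
      ∑ (allVecs (suc n) k) h
    ≡⟨ cong (λ xs → ∑ xs h) (allVecs-suc n k) ⟩
      ∑ (concatMap (λ v → map (_∷ v) (colours k)) (allVecs n k)) h
    ≡⟨ ∑-concatMap (λ v → map (_∷ v) (colours k)) (allVecs n k) h ⟩
      ∑[ v ∈ allVecs n k ] ∑ (map (_∷ v) (colours k)) h
    ≡⟨ ∑-cong (allVecs n k) (λ v → ∑-map (_∷ v) (colours k) h) ⟩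
      ∑[ v ∈ allVecs n k ] ∑[ x ∈ colours k ] h (x ∷ v) ∎
    where open ≡-Reasoning

  ∑-≟ : ∀ {k} (c : Fin k) → ∑[ x ∈ colours k ] ⟦ x ≟ c ⟧ ≡ 1
  ∑-≟ {suc k} c = trans (cong (λ xs → ∑[ x ∈ xs ] ⟦ x ≟ c ⟧) (colours-suc k)) (∑-≟-suc c)
    where
    ∑-≟-suc : (c : Fin (suc k)) → ∑[ x ∈ zero ∷ map suc (colours k) ] ⟦ x ≟ c ⟧ ≡ 1
    ∑-≟-suc zero    = cong suc (trans (∑-map suc (colours k) _) (∑-zero (colours k)))
    ∑-≟-suc (suc c) = trans (∑-map suc (colours k) _) (∑-≟ c)

  ∑-≢ : ∀ {k} (c : Fin k) → ∑[ x ∈ colours k ] ⟦ ¬? (x ≟ c) ⟧ + 1 ≡ k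
  ∑-≢ {k} c = begin
      ∑[ x ∈ colours k ] ⟦ ¬? (x ≟ c) ⟧ + 1
    ≡⟨ cong (∑[ x ∈ colours k ] ⟦ ¬? (x ≟ c) ⟧ +_) (sym (∑-≟ c)) ⟩
      ∑[ x ∈ colours k ] ⟦ ¬? (x ≟ c) ⟧ + ∑[ x ∈ colours k ] ⟦ x ≟ c ⟧
    ≡⟨ +-comm (∑[ x ∈ colours k ] ⟦ ¬? (x ≟ c) ⟧) _ ⟩
      ∑[ x ∈ colours k ] ⟦ x ≟ c ⟧ + ∑[ x ∈ colours k ] ⟦ ¬? (x ≟ c) ⟧
    ≡⟨ ∑⟦P⟧+∑⟦¬P⟧≡length (_≟ c) (colours k) ⟩
      length (colours k)
    ≡⟨ length-colours k ⟩
      k ∎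
    where open ≡-Reasoning

  module _ {k : ℕ} (a : Fin k) where

    ∑-isNone-insert : ∀ s → ∑[ x ∈ colours k ] isNone (insert a x s) ≡ isNone s
    ∑-isNone-insert none    = trans (∑-cong (colours k) isNone-insert-none) (∑-≟ a)
      where
      isNone-insert-none : ∀ x → isNone (insert a x none) ≡ ⟦ x ≟ a ⟧
      isNone-insert-none x with x ≟ a
      ... | yes _ = refl
      ... | no _  = refl
    ∑-isNone-insert (one b) = trans (∑-cong (colours k) isNone-insert-one) (∑-zero (colours k))
      where
      isNone-insert-one : ∀ x → isNone (insert a x (one b)) ≡ 0
      isNone-insert-one x with x ≟ a
      ... | yes _ = refl
      ... | no _ with x ≟ b
      ...   | yes _ = refl
      ...   | no _  = refl
    ∑-isNone-insert many    = trans (∑-cong (colours k) isNone-insert-many) (∑-zero (colours k))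
      where
      isNone-insert-many : ∀ x → isNone (insert a x many) ≡ 0
      isNone-insert-many x with x ≟ a
      ... | yes _ = refl
      ... | no _  = refl

    ∑-isOne-insert : ∀ {n} {v : Vec (Fin k) n} s → Describes a v s →
                     ∑[ x ∈ colours k ] isOne (insert a x s) + isNone s ≡ k * isNone s + 2 * isOne s
    ∑-isOne-insert none _ = begin
        ∑[ x ∈ colours k ] isOne (insert a x none) + 1  ≡⟨ cong (_+ 1) (∑-cong (colours k) isOne-insert-none) ⟩
        ∑[ x ∈ colours k ] ⟦ ¬? (x ≟ a) ⟧ + 1           ≡⟨ ∑-≢ a ⟩
        k                                              ≡⟨ sym (trans (+-identityʳ _) (*-identityʳ k)) ⟩
        k * 1 + 2 * 0                                  ∎
      where
      open ≡-Reasoning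
      isOne-insert-none : ∀ x → isOne (insert a x none) ≡ ⟦ ¬? (x ≟ a) ⟧
      isOne-insert-none x with x ≟ a
      ... | yes _ = refl
      ... | no _  = refl
    ∑-isOne-insert (one b) (b≢a , _) = begin
        ∑[ x ∈ colours k ] isOne (insert a x (one b)) + 0  ≡⟨ +-identityʳ _ ⟩
        ∑[ x ∈ colours k ] isOne (insert a x (one b))      ≡⟨ ∑-cong (colours k) isOne-insert-one ⟩
        ∑[ x ∈ colours k ] (⟦ x ≟ a ⟧ + ⟦ x ≟ b ⟧)          ≡⟨ ∑-+ (colours k) _ _ ⟩
        ∑[ x ∈ colours k ] ⟦ x ≟ a ⟧ + ∑[ x ∈ colours k ] ⟦ x ≟ b ⟧ ≡⟨ cong₂ _+_ (∑-≟ a) (∑-≟ b) ⟩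
        2                                                  ≡⟨ cong (_+ 2) (sym (*-zeroʳ k)) ⟩
        k * 0 + 2 * 1                                      ∎
      where
      open ≡-Reasoning
      isOne-insert-one : ∀ x → isOne (insert a x (one b)) ≡ ⟦ x ≟ a ⟧ + ⟦ x ≟ b ⟧
      isOne-insert-one x with x ≟ a
      isOne-insert-one x | yes x≡a with x ≟ b
      ... | yes x≡b = ⊥-elim (b≢a (trans (sym x≡b) x≡a))
      ... | no _    = refl
      isOne-insert-one x | no _ with x ≟ b
      ... | yes _ = refl
      ... | no _  = refl
    ∑-isOne-insert many _ = begin
        ∑[ x ∈ colours k ] isOne (insert a x many) + 0  ≡⟨ +-identityʳ _ ⟩
        ∑[ x ∈ colours k ] isOne (insert a x many)      ≡⟨ ∑-cong (colours k) isOne-insert-many ⟩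
        ∑[ x ∈ colours k ] 0                            ≡⟨ ∑-zero (colours k) ⟩
        0                                              ≡⟨ sym (trans (+-identityʳ _) (*-zeroʳ k)) ⟩
        k * 0 + 2 * 0                                  ∎
      where
      open ≡-Reasoning
      isOne-insert-many : ∀ x → isOne (insert a x many) ≡ 0
      isOne-insert-many x with x ≟ a
      ... | yes _ = refl
      ... | no _  = refl

    noneCount oneCount : ℕ → ℕ
    noneCount n = ∑[ v ∈ allVecs n k ] isNone (otherColours a v)
    oneCount  n = ∑[ v ∈ allVecs n k ] isOne (otherColours a v)

    noneCount≡1 : ∀ n → noneCount n ≡ 1
    noneCount≡1 zero    = refl
    noneCount≡1 (suc n) = begin
        noneCount (suc n)
      ≡⟨ ∑-allVecs-suc n k _ ⟩
        ∑[ v ∈ allVecs n k ] ∑[ x ∈ colours k ] isNone (insert a x (otherColours a v))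
      ≡⟨ ∑-cong (allVecs n k) (λ v → ∑-isNone-insert (otherColours a v)) ⟩
        noneCount n
      ≡⟨ noneCount≡1 n ⟩
        1 ∎
      where open ≡-Reasoning

    oneCount-suc : ∀ n → oneCount (suc n) + 1 ≡ k + 2 * oneCount n
    oneCount-suc n = begin
        oneCount (suc n) + 1
      ≡⟨ cong₂ _+_ (∑-allVecs-suc n k _) (sym (noneCount≡1 n)) ⟩
        ∑[ v ∈ allVecs n k ] ∑[ x ∈ colours k ] isOne (insert a x (otherColours a v)) + noneCount n
      ≡⟨ sym (∑-+ (allVecs n k) _ _) ⟩
        ∑[ v ∈ allVecs n k ] (∑[ x ∈ colours k ] isOne (insert a x (otherColours a v)) + isNone (otherColours a v))
      ≡⟨ ∑-cong (allVecs n k) (λ v → ∑-isOne-insert (otherColours a v) (otherColours-describes a v)) ⟩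
        ∑[ v ∈ allVecs n k ] (k * isNone (otherColours a v) + 2 * isOne (otherColours a v))
      ≡⟨ ∑-+ (allVecs n k) _ _ ⟩
        ∑[ v ∈ allVecs n k ] (k * isNone (otherColours a v)) + ∑[ v ∈ allVecs n k ] (2 * isOne (otherColours a v))
      ≡⟨ cong₂ _+_ (∑-*ˡ k (allVecs n k) _) (∑-*ˡ 2 (allVecs n k) _) ⟩
        k * noneCount n + 2 * oneCount n
      ≡⟨ cong (λ m → k * m + 2 * oneCount n) (noneCount≡1 n) ⟩
        k * 1 + 2 * oneCount n
      ≡⟨ cong (_+ 2 * oneCount n) (*-identityʳ k) ⟩
        k + 2 * oneCount n ∎
      where open ≡-Reasoning

    w≡1+oneCount : ∀ {n} {φ : Coloring n k} → ((i j : Fin n) (p : i < j) → φ i j p ≡ a) → w φ ≡ 1 + oneCount n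
    w≡1+oneCount {n} {φ} φ≡a = begin
        w φ
      ≡⟨ length-filter≡∑ (λ f → gallai? (extend φ f)) (allVecs n k) ⟩
        ∑[ f ∈ allVecs n k ] ⟦ gallai? (extend φ f) ⟧
      ≡⟨ ∑-cong (allVecs n k) gallai≡few ⟩
        ∑[ f ∈ allVecs n k ] (isNone (otherColours a f) + isOne (otherColours a f))
      ≡⟨ ∑-+ (allVecs n k) _ _ ⟩
        noneCount n + oneCount n
      ≡⟨ cong (_+ oneCount n) (noneCount≡1 n) ⟩
        1 + oneCount n ∎
      where
      open ≡-Reasoning
      gallai≡few : ∀ f → ⟦ gallai? (extend φ f) ⟧ ≡ isNone (otherColours a f) + isOne (otherColours a f)
      gallai≡few f = trans
        (cong (λ b → if b then 1 else 0)
              (does-⇔ (gallai-extend⇔≢many φ≡a f) (gallai? (extend φ f)) (few? (otherColours a f))))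
        (⟦few?⟧ (otherColours a f))

open import Data.Integer using (ℤ; +_; _+_; _-_; _*_)
open import Data.Integer.Properties using (pos-+; pos-*; *-zeroʳ)
open import Data.Integer.Tactic.RingSolver using (solve-∀)
import Data.Nat as ℕ

doubling-closed-form : ∀ k (t : ℕ → ℕ) → t 0 ≡ 0 → (∀ n → t (suc n) ℕ.+ 1 ≡ k ℕ.+ 2 ℕ.* t n) →
                       ∀ n → + t n ≡ (+ k - + 1) * (+ (2 ^ n) - + 1)
doubling-closed-form k t t0≡0 t-suc zero    = trans (cong +_ t0≡0) (sym (*-zeroʳ (+ k - + 1)))
doubling-closed-form k t t0≡0 t-suc (suc n) = begin
    + t (suc n)
  ≡⟨ add-sub (+ t (suc n)) ⟩
    + t (suc n) + + 1 - + 1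
  ≡⟨ cong (_- + 1) t-suc-ℤ ⟩
    + k + + 2 * + t n - + 1
  ≡⟨ cong (λ m → + k + + 2 * m - + 1) (doubling-closed-form k t t0≡0 t-suc n) ⟩
    + k + + 2 * ((+ k - + 1) * (+ (2 ^ n) - + 1)) - + 1
  ≡⟨ doubling-step (+ k) (+ (2 ^ n)) ⟩
    (+ k - + 1) * (+ 2 * + (2 ^ n) - + 1)
  ≡⟨ cong (λ m → (+ k - + 1) * (m - + 1)) (sym (pos-* 2 (2 ^ n))) ⟩
    (+ k - + 1) * (+ (2 ^ suc n) - + 1) ∎
  where
  open ≡-Reasoning
  add-sub : ∀ (x : ℤ) → x ≡ x + + 1 - + 1
  add-sub = solve-∀
  doubling-step : ∀ (k p : ℤ) → k + + 2 * ((k - + 1) * (p - + 1)) - + 1 ≡ (k - + 1) * (+ 2 * p - + 1)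
  doubling-step = solve-∀
  t-suc-ℤ : + t (suc n) + + 1 ≡ + k + + 2 * + t n
  t-suc-ℤ = begin
      + t (suc n) + + 1       ≡⟨ sym (pos-+ (t (suc n)) 1) ⟩
      + (t (suc n) ℕ.+ 1)     ≡⟨ cong +_ (t-suc n) ⟩
      + (k ℕ.+ 2 ℕ.* t n)     ≡⟨ pos-+ k (2 ℕ.* t n) ⟩
      + k + + (2 ℕ.* t n)     ≡⟨ cong (λ m → + k + m) (pos-* 2 (t n)) ⟩
      + k + + 2 * + t n       ∎

fact2p1 : (k n : ℕ) → 1 ≤ k → 1 ≤ n → (φ : Coloring n k) → Monochromatic φ →
    + (w φ) ≡ (+ k - + 1) * + (2 ^ n) - (+ k - + 2)
fact2p1 k n _ _ φ (a , φ≡a) = begin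
    + w φ
  ≡⟨ cong +_ (w≡1+oneCount a φ≡a) ⟩
    + 1 + + oneCount a n
  ≡⟨ cong (λ m → + 1 + m) (doubling-closed-form k (oneCount a) refl (oneCount-suc a) n) ⟩
    + 1 + (+ k - + 1) * (+ (2 ^ n) - + 1)
  ≡⟨ rearrange (+ k) (+ (2 ^ n)) ⟩
    (+ k - + 1) * + (2 ^ n) - (+ k - + 2) ∎
  where
  open ≡-Reasoning
  rearrange : ∀ (k p : ℤ) → + 1 + (k - + 1) * (p - + 1) ≡ (k - + 1) * p - (k - + 2)
  rearrange = solve-∀
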